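{- Let $0<\mu<1$ and write $\mu=\sum_{i\ge0}2^{ -k_i}$ where $1\le k_0<k_1<\cdots$ are the positions of the $1$'s in the binary expansion of $\mu$ (a finite sum, using the terminating expansion, when $\mu$ is a dyadic rational). Then $\mathbf{I}[\ell\langle\mu\rangle]=\sum_{i\ge0}(k_i-2i)\,2^{1-k_i}$.
   Context: $\mathrm{true}=-1$, $\mathrm{false}=+1$, $N=2^n$. For $x\in\{ -1,1\}^n$ let $\mathrm{val}(x)=\sum_{i=1}^n b_i2^{n-i}$ with $b_i=0$ if $x_i=\mathrm{true}$, $b_i=1$ if $x_i=\mathrm{false}$. For an integer $0\le s\le N$, $\ell_n\langle s\rangle$ is the Boolean function on $n$ variables that is $\mathrm{true}$ exactly when $\mathrm{val}(x)<s$; for real $0\le\mu\le1$, $\ell_n\langle\mu\rangle=\ell_n\langle\lfloor\mu N\rfloor\rangle$. The total influence of a Boolean function is $\mathbf{I}[f]=\sum_S\hat f(S)^2|S|$ with $\hat f(S)=\mathbf{E}_x[f(x)\prod_{i\in S}x_i]$, $x$ uniform. The infinite lexicographic function $\ell\langle\mu\rangle$ has total influence defined by $\mathbf{I}[\ell\langle\mu\rangle]=\lim_{n\to\infty}\mathbf{I}[\ell_n\langle\mu\rangle]$. -}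

module Defs where

open import Data.Bool using (Bool; true; false; if_then_else_)
open import Data.Nat as ℕ using (ℕ; zero; suc; _<ᵇ_; _^_)
open import Data.Vec using (Vec; []; _∷_)
open import Data.List using (List; []; _∷_; map; concatMap; foldr)
open import Data.Integer as ℤ using (ℤ; +_)
open import Data.Rational using (ℚ; 0ℚ; 1ℚ; ½; _+_; _*_; -_; _/_)

-- Encoding of the cube {-1,1}^n: a point is a Vec Bool n whose i-th entry is the
-- binary digit b_i of the paper, i.e. entry true  <->  b_i = 1  <->  x_i = false = +1,
-- and entry false <-> b_i = 0 <-> x_i = true = -1.
-- A subset S of [n] is likewise a Vec Bool n (characteristic vector).

allVecs : (n : ℕ) → List (Vec Bool n)
allVecs zero = [] ∷ []
allVecs (suc n) = concatMap (λ v → (false ∷ v) ∷ (true ∷ v) ∷ []) (allVecs n)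

sumL : List ℚ → ℚ
sumL = foldr _+_ 0ℚ

sign : Bool → ℚ
sign true = 1ℚ
sign false = - 1ℚ

val : ∀ {n} → Vec Bool n → ℕ
val [] = 0
val {suc n} (b ∷ v) = (if b then 2 ^ n else 0) ℕ.+ val v

inv2^ : ℕ → ℚ
inv2^ zero = 1ℚ
inv2^ (suc n) = ½ * inv2^ n

chi : ∀ {n} → Vec Bool n → Vec Bool n → ℚ
chi [] [] = 1ℚ
chi (true ∷ S) (c ∷ x) = sign c * chi S x
chi (false ∷ S) (c ∷ x) = chi S x

card : ∀ {n} → Vec Bool n → ℕ
card [] = 0
card (true ∷ S) = suc (card S)
card (false ∷ S) = card S

fourier : ∀ {n} → (Vec Bool n → ℚ) → Vec Bool n → ℚ
fourier {n} f S = inv2^ n * sumL (map (λ x → f x * chi S x) (allVecs n))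

influence : ∀ {n} → (Vec Bool n → ℚ) → ℚ
influence {n} f =
  sumL (map (λ S → fourier f S * fourier f S * ((+ card S) / 1)) (allVecs n))

lexFun : (n s : ℕ) → Vec Bool n → ℚ
lexFun n s x = if val x <ᵇ s then - 1ℚ else 1ℚ

-- A real μ ∈ (0,1) is given by its binary digits b : ℕ → Bool, where b j is the
-- digit of 2^{-(j+1)} (the non-terminating-in-ones expansion, i.e. the terminating
-- one for dyadic rationals).  prefix b n = ⌊ μ 2^n ⌋ = Σ_{j<n} b_j 2^{n-1-j}.
prefix : (ℕ → Bool) → ℕ → ℕ
prefix b zero = 0
prefix b (suc n) = 2 ℕ.* prefix b n ℕ.+ (if b n then 1 else 0)

lexInfluence : (ℕ → Bool) → ℕ → ℚ
lexInfluence b n = influence (lexFun n (prefix b n))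

-- number of 1-digits among b 0 .. b (j-1); if b j = true, the digit at position
-- k = j+1 is k_i with i = ones b j
ones : (ℕ → Bool) → ℕ → ℕ
ones b zero = 0
ones b (suc j) = ones b j ℕ.+ (if b j then 1 else 0)

-- partial sum  Σ_{i : k_i ≤ m} (k_i - 2i) 2^{1-k_i}
partialSum : (ℕ → Bool) → ℕ → ℚ
partialSum b zero = 0ℚ
partialSum b (suc j) = partialSum b j +
  (if b j then ((+ suc j ℤ.- + (2 ℕ.* ones b j)) / 1) * inv2^ j else 0ℚ)

-- Splitting the cube on its first coordinate gives
-- I[f] = ½ (I[f₀] + I[f₁]) + ¼ 𝔼[(f₁ − f₀)²].  For ℓ_{n+1}⟨s⟩ one of the halves
-- is the constant ±1 and the other is ℓ_n⟨s′⟩, where s′ is s without its leading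
-- binary digit.  So the mean and the influence of ℓ_n⟨⌊μ 2ⁿ⌋⟩ satisfy a
-- recursion in the leading digit of μ, and the partial sums of
-- Σ (k_i − 2i) 2^{1−k_i} satisfy the same one: I[ℓ_n⟨μ⟩] is exactly the sum of
-- the terms with k_i ≤ n.  These terms are bounded by 2 k_i 2^{1−k_i}, which gives
-- the Cauchy bound (4N + 8) 2^{−N} beyond N.

module Submission where

open import Defs
open import Data.Bool using (Bool; true; false; if_then_else_)
open import Data.Nat as ℕ using (ℕ; zero; suc; _≤_; _^_; _<ᵇ_; z≤n; s≤s)
import Data.Nat.Properties as ℕₚ
import Data.Nat.Coprimality as Coprime
open import Data.Integer as ℤ using (+_; +[1+_]; -[1+_])
import Data.Integer.Properties as ℤₚ
open import Data.Rational
  using (ℚ; mkℚ; 0ℚ; 1ℚ; ½; _+_; _*_; -_; _-_; _/_; 1/_; ∣_∣; _<_; *≤*; toℚᵘ; nonNegative; positive)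
  renaming (_≤_ to _≤ℚ_)
import Data.Rational.Properties as ℚₚ
import Data.Rational.Unnormalised as ℚᵘ
import Data.Rational.Unnormalised.Properties as ℚᵘₚ
open import Data.Rational.Solver using (module +-*-Solver)
open import Data.Vec using (Vec; []; _∷_)
open import Data.List using ([]; _∷_; map; concatMap)
open import Data.List.Properties using (map-cong)
open import Data.Product using (∃-syntax; _×_; _,_)
open import Data.Sum using (_⊎_; inj₁; inj₂)
open import Relation.Nullary using (contradiction)
open import Relation.Binary.PropositionalEquality
  using (_≡_; refl; sym; trans; cong; cong₂; subst; module ≡-Reasoning)
open +-*-Solver

sq : ℚ → ℚ
sq x = x * x

-- `i / 1` unfolds to `fromℚᵘ (mkℚᵘ i 0)`, so the homomorphism laws come from ℚᵘ.
ℤ→ℚ-homo-+ : ∀ i j → (i ℤ.+ j) / 1 ≡ i / 1 + j / 1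
ℤ→ℚ-homo-+ i j = ℚₚ.toℚᵘ-injective (begin
  toℚᵘ ((i ℤ.+ j) / 1)                ≈⟨ ℚₚ.toℚᵘ-fromℚᵘ (ℚᵘ.mkℚᵘ (i ℤ.+ j) 0) ⟩
  ℚᵘ.mkℚᵘ (i ℤ.+ j) 0                 ≈⟨ ℚᵘ.*≡* (cong (ℤ._* + 1) (cong₂ ℤ._+_ (sym (ℤₚ.*-identityʳ i)) (sym (ℤₚ.*-identityʳ j)))) ⟩
  ℚᵘ.mkℚᵘ i 0 ℚᵘ.+ ℚᵘ.mkℚᵘ j 0        ≈⟨ ℚᵘₚ.+-cong (ℚₚ.toℚᵘ-fromℚᵘ (ℚᵘ.mkℚᵘ i 0)) (ℚₚ.toℚᵘ-fromℚᵘ (ℚᵘ.mkℚᵘ j 0)) ⟨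
  toℚᵘ (i / 1) ℚᵘ.+ toℚᵘ (j / 1)      ≈⟨ ℚₚ.toℚᵘ-homo-+ (i / 1) (j / 1) ⟨
  toℚᵘ (i / 1 + j / 1)                ∎)
  where open ℚᵘₚ.≃-Reasoning

ℤ→ℚ-homo-neg : ∀ i → (ℤ.- i) / 1 ≡ - (i / 1)
ℤ→ℚ-homo-neg i = ℚₚ.toℚᵘ-injective (begin
  toℚᵘ ((ℤ.- i) / 1)         ≈⟨ ℚₚ.toℚᵘ-fromℚᵘ (ℚᵘ.mkℚᵘ (ℤ.- i) 0) ⟩
  ℚᵘ.- ℚᵘ.mkℚᵘ i 0           ≈⟨ ℚᵘₚ.-‿cong (ℚₚ.toℚᵘ-fromℚᵘ (ℚᵘ.mkℚᵘ i 0)) ⟨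
  ℚᵘ.- toℚᵘ (i / 1)          ≈⟨ ℚₚ.toℚᵘ-homo‿- (i / 1) ⟨
  toℚᵘ (- (i / 1))           ∎)
  where open ℚᵘₚ.≃-Reasoning

fromℕ : ℕ → ℚ
fromℕ n = + n / 1

fromℕ-homo-+ : ∀ m n → fromℕ (m ℕ.+ n) ≡ fromℕ m + fromℕ n
fromℕ-homo-+ m n = ℤ→ℚ-homo-+ (+ m) (+ n)

fromℕ-suc : ∀ n → fromℕ (suc n) ≡ 1ℚ + fromℕ n
fromℕ-suc = fromℕ-homo-+ 1

fromℕ-homo-* : ∀ m n → fromℕ (m ℕ.* n) ≡ fromℕ m * fromℕ n
fromℕ-homo-* zero n = sym (ℚₚ.*-zeroˡ (fromℕ n))
fromℕ-homo-* (suc m) n = begin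
  fromℕ (n ℕ.+ m ℕ.* n)        ≡⟨ trans (fromℕ-homo-+ n (m ℕ.* n)) (cong (λ x → fromℕ n + x) (fromℕ-homo-* m n)) ⟩
  fromℕ n + fromℕ m * fromℕ n  ≡⟨ solve 2 (λ x y → y :+ x :* y := (con 1ℚ :+ x) :* y) refl (fromℕ m) (fromℕ n) ⟩
  (1ℚ + fromℕ m) * fromℕ n     ≡⟨ cong (_* fromℕ n) (fromℕ-suc m) ⟨
  fromℕ (suc m) * fromℕ n      ∎
  where open ≡-Reasoning

fromℕ-nonNeg : ∀ n → 0ℚ ≤ℚ fromℕ n
fromℕ-nonNeg n = ℚₚ.nonNegative⁻¹ _ {{ℚₚ.normalize-nonNeg n 1}}

p≤p+q : ∀ p {q} → 0ℚ ≤ℚ q → p ≤ℚ p + q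
p≤p+q p {q} 0≤q = subst (_≤ℚ p + q) (ℚₚ.+-identityʳ p) (ℚₚ.+-monoʳ-≤ p 0≤q)

fromℕ-mono-≤ : ∀ {m n} → m ≤ n → fromℕ m ≤ℚ fromℕ n
fromℕ-mono-≤ {m} {n} m≤n = subst (fromℕ m ≤ℚ_)
  (trans (sym (fromℕ-homo-+ m (n ℕ.∸ m))) (cong fromℕ (ℕₚ.m+[n∸m]≡n m≤n)))
  (p≤p+q (fromℕ m) (fromℕ-nonNeg (n ℕ.∸ m)))

∣ℤ→ℚ∣ : ∀ i → ∣ i / 1 ∣ ≡ fromℕ ℤ.∣ i ∣
∣ℤ→ℚ∣ (+ n) = ℚₚ.0≤p⇒∣p∣≡p (fromℕ-nonNeg n)
∣ℤ→ℚ∣ -[1+ n ] = trans (ℚₚ.∣-p∣≡∣p∣ (fromℕ (suc n))) (ℚₚ.0≤p⇒∣p∣≡p (fromℕ-nonNeg (suc n)))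

*-nonNeg : ∀ {p q} → 0ℚ ≤ℚ p → 0ℚ ≤ℚ q → 0ℚ ≤ℚ p * q
*-nonNeg {p} {q} 0≤p 0≤q = subst (_≤ℚ p * q) (ℚₚ.*-zeroˡ q) (ℚₚ.*-monoʳ-≤-nonNeg q {{nonNegative 0≤q}} 0≤p)

inv2^-nonNeg : ∀ n → 0ℚ ≤ℚ inv2^ n
inv2^-nonNeg zero = ℚₚ.nonNegative⁻¹ 1ℚ
inv2^-nonNeg (suc n) = *-nonNeg (ℚₚ.nonNegative⁻¹ ½) (inv2^-nonNeg n)

fromℕ-2^*inv2^ : ∀ n → fromℕ (2 ^ n) * inv2^ n ≡ 1ℚ
fromℕ-2^*inv2^ zero = refl
fromℕ-2^*inv2^ (suc n) = begin
  fromℕ (2 ℕ.* 2 ^ n) * (½ * inv2^ n)   ≡⟨ cong (_* (½ * inv2^ n)) (fromℕ-homo-* 2 (2 ^ n)) ⟩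
  fromℕ 2 * fromℕ (2 ^ n) * (½ * inv2^ n) ≡⟨ solve 2 (λ x i → con (fromℕ 2) :* x :* (con ½ :* i) := x :* i) refl (fromℕ (2 ^ n)) (inv2^ n) ⟩
  fromℕ (2 ^ n) * inv2^ n               ≡⟨ fromℕ-2^*inv2^ n ⟩
  1ℚ                                    ∎
  where open ≡-Reasoning

-- Averages over the cube

lowerHalf upperHalf : ∀ {n} → (Vec Bool (suc n) → ℚ) → Vec Bool n → ℚ
lowerHalf f x = f (false ∷ x)
upperHalf f x = f (true ∷ x)

cubeSum : ∀ n → (Vec Bool n → ℚ) → ℚ
cubeSum n h = sumL (map h (allVecs n))

𝔼 : ∀ n → (Vec Bool n → ℚ) → ℚ
𝔼 n h = inv2^ n * cubeSum n h

cubeSum-cong : ∀ {n} {g h : Vec Bool n → ℚ} → (∀ x → g x ≡ h x) → cubeSum n g ≡ cubeSum n h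
cubeSum-cong {n} g≗h = cong sumL (map-cong g≗h (allVecs n))

cubeSum-+ : ∀ n (g h : Vec Bool n → ℚ) → cubeSum n (λ x → g x + h x) ≡ cubeSum n g + cubeSum n h
cubeSum-+ n g h = go (allVecs n)
  where
  go : ∀ xs → sumL (map (λ x → g x + h x) xs) ≡ sumL (map g xs) + sumL (map h xs)
  go [] = refl
  go (x ∷ xs) = trans (cong (λ s → g x + h x + s) (go xs))
    (solve 4 (λ a b A B → a :+ b :+ (A :+ B) := a :+ A :+ (b :+ B)) refl (g x) (h x) (sumL (map g xs)) (sumL (map h xs)))

cubeSum-scale : ∀ n c (h : Vec Bool n → ℚ) → cubeSum n (λ x → c * h x) ≡ c * cubeSum n h
cubeSum-scale n c h = go (allVecs n)
  where
  go : ∀ xs → sumL (map (λ x → c * h x) xs) ≡ c * sumL (map h xs)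
  go [] = sym (ℚₚ.*-zeroʳ c)
  go (x ∷ xs) = trans (cong (λ s → c * h x + s) (go xs)) (sym (ℚₚ.*-distribˡ-+ c (h x) (sumL (map h xs))))

cubeSum-linear : ∀ n p q (g h : Vec Bool n → ℚ) →
  cubeSum n (λ x → p * g x + q * h x) ≡ p * cubeSum n g + q * cubeSum n h
cubeSum-linear n p q g h = trans (cubeSum-+ n _ _) (cong₂ _+_ (cubeSum-scale n p g) (cubeSum-scale n q h))

cubeSum-suc : ∀ n (h : Vec Bool (suc n) → ℚ) → cubeSum (suc n) h ≡ cubeSum n (lowerHalf h) + cubeSum n (upperHalf h)
cubeSum-suc n h = go (allVecs n)
  where
  go : ∀ xs → sumL (map h (concatMap (λ v → (false ∷ v) ∷ (true ∷ v) ∷ []) xs))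
            ≡ sumL (map (lowerHalf h) xs) + sumL (map (upperHalf h) xs)
  go [] = refl
  go (x ∷ xs) = trans (cong (λ s → h (false ∷ x) + (h (true ∷ x) + s)) (go xs))
    (solve 4 (λ a b A B → a :+ (b :+ (A :+ B)) := a :+ A :+ (b :+ B)) refl
      (h (false ∷ x)) (h (true ∷ x)) (sumL (map (lowerHalf h) xs)) (sumL (map (upperHalf h) xs)))

𝔼-cong : ∀ {n} {g h : Vec Bool n → ℚ} → (∀ x → g x ≡ h x) → 𝔼 n g ≡ 𝔼 n h
𝔼-cong {n} g≗h = cong (inv2^ n *_) (cubeSum-cong g≗h)

𝔼-linear : ∀ n p q (g h : Vec Bool n → ℚ) → 𝔼 n (λ x → p * g x + q * h x) ≡ p * 𝔼 n g + q * 𝔼 n h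
𝔼-linear n p q g h = trans (cong (inv2^ n *_) (cubeSum-linear n p q g h))
  (solve 5 (λ i p q G H → i :* (p :* G :+ q :* H) := p :* (i :* G) :+ q :* (i :* H)) refl
    (inv2^ n) p q (cubeSum n g) (cubeSum n h))

𝔼-scale : ∀ n c (h : Vec Bool n → ℚ) → 𝔼 n (λ x → c * h x) ≡ c * 𝔼 n h
𝔼-scale n c h = trans (cong (inv2^ n *_) (cubeSum-scale n c h))
  (solve 3 (λ i c H → i :* (c :* H) := c :* (i :* H)) refl (inv2^ n) c (cubeSum n h))

𝔼-suc : ∀ n (h : Vec Bool (suc n) → ℚ) → 𝔼 (suc n) h ≡ ½ * (𝔼 n (lowerHalf h) + 𝔼 n (upperHalf h))
𝔼-suc n h = trans (cong (½ * inv2^ n *_) (cubeSum-suc n h))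
  (solve 3 (λ i a b → con ½ :* i :* (a :+ b) := con ½ :* (i :* a :+ i :* b)) refl
    (inv2^ n) (cubeSum n (lowerHalf h)) (cubeSum n (upperHalf h)))

𝔼-const : ∀ n c → 𝔼 n (λ _ → c) ≡ c
𝔼-const zero c = trans (ℚₚ.*-identityˡ (c + 0ℚ)) (ℚₚ.+-identityʳ c)
𝔼-const (suc n) c = trans (𝔼-suc n (λ _ → c))
  (trans (cong (λ e → ½ * (e + e)) (𝔼-const n c)) (solve 1 (λ c → con ½ :* (c :+ c) := c) refl c))

-- Fourier coefficients and total influence

fourier-cong : ∀ {n} {g h : Vec Bool n → ℚ} → (∀ x → g x ≡ h x) → ∀ T → fourier g T ≡ fourier h T
fourier-cong g≗h T = 𝔼-cong (λ x → cong (_* chi T x) (g≗h x))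

fourier-false∷ : ∀ {n} (f : Vec Bool (suc n) → ℚ) T →
  fourier f (false ∷ T) ≡ ½ * (fourier (lowerHalf f) T + fourier (upperHalf f) T)
fourier-false∷ {n} f T = 𝔼-suc n (λ x → f x * chi (false ∷ T) x)

fourier-true∷ : ∀ {n} (f : Vec Bool (suc n) → ℚ) T →
  fourier f (true ∷ T) ≡ ½ * (fourier (upperHalf f) T - fourier (lowerHalf f) T)
fourier-true∷ {n} f T = begin
  fourier f (true ∷ T)
    ≡⟨ 𝔼-suc n (λ x → f x * chi (true ∷ T) x) ⟩
  ½ * (𝔼 n (λ x → f (false ∷ x) * (- 1ℚ * chi T x)) + 𝔼 n (λ x → f (true ∷ x) * (1ℚ * chi T x)))
    ≡⟨ cong₂ (λ a b → ½ * (a + b))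
         (trans (𝔼-cong (λ x → reassoc (f (false ∷ x)) (- 1ℚ) (chi T x))) (𝔼-scale n (- 1ℚ) _))
         (trans (𝔼-cong (λ x → reassoc (f (true ∷ x)) 1ℚ (chi T x))) (𝔼-scale n 1ℚ _)) ⟩
  ½ * (- 1ℚ * a + 1ℚ * b)
    ≡⟨ solve 2 (λ a b → con ½ :* (con (- 1ℚ) :* a :+ con 1ℚ :* b) := con ½ :* (b :- a)) refl a b ⟩
  ½ * (b - a) ∎
  where
  open ≡-Reasoning
  a = fourier (lowerHalf f) T
  b = fourier (upperHalf f) T
  reassoc : ∀ y c χ → y * (c * χ) ≡ c * (y * χ)
  reassoc = solve 3 (λ y c χ → y :* (c :* χ) := c :* (y :* χ)) refl

fourier-sub : ∀ {n} (g h : Vec Bool n → ℚ) T → fourier (λ x → g x - h x) T ≡ fourier g T - fourier h T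
fourier-sub {n} g h T = begin
  𝔼 n (λ x → (g x - h x) * chi T x)
    ≡⟨ 𝔼-cong (λ x → solve 3 (λ a b c → (a :- b) :* c := con 1ℚ :* (a :* c) :+ con (- 1ℚ) :* (b :* c)) refl (g x) (h x) (chi T x)) ⟩
  𝔼 n (λ x → 1ℚ * (g x * chi T x) + - 1ℚ * (h x * chi T x))
    ≡⟨ 𝔼-linear n 1ℚ (- 1ℚ) _ _ ⟩
  1ℚ * fourier g T + - 1ℚ * fourier h T
    ≡⟨ solve 2 (λ a b → con 1ℚ :* a :+ con (- 1ℚ) :* b := a :- b) refl (fourier g T) (fourier h T) ⟩
  fourier g T - fourier h T ∎
  where open ≡-Reasoning

parseval : ∀ n (f : Vec Bool n → ℚ) → cubeSum n (λ T → sq (fourier f T)) ≡ 𝔼 n (λ x → sq (f x))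
parseval zero f = solve 1 (λ y → (con 1ℚ :* (y :* con 1ℚ :+ con 0ℚ)) :* (con 1ℚ :* (y :* con 1ℚ :+ con 0ℚ)) :+ con 0ℚ
  := con 1ℚ :* (y :* y :+ con 0ℚ)) refl (f [])
parseval (suc n) f = begin
  cubeSum (suc n) (λ T → sq (fourier f T))
    ≡⟨ cubeSum-suc n _ ⟩
  cubeSum n (λ T → sq (fourier f (false ∷ T))) + cubeSum n (λ T → sq (fourier f (true ∷ T)))
    ≡⟨ cubeSum-+ n _ _ ⟨
  cubeSum n (λ T → sq (fourier f (false ∷ T)) + sq (fourier f (true ∷ T)))
    ≡⟨ cubeSum-cong (λ T → trans (cong₂ (λ u v → sq u + sq v) (fourier-false∷ f T) (fourier-true∷ f T))
                                 (half-parallelogram (a T) (b T))) ⟩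
  cubeSum n (λ T → ½ * sq (a T) + ½ * sq (b T))
    ≡⟨ cubeSum-linear n ½ ½ _ _ ⟩
  ½ * cubeSum n (λ T → sq (a T)) + ½ * cubeSum n (λ T → sq (b T))
    ≡⟨ cong₂ (λ u v → ½ * u + ½ * v) (parseval n (lowerHalf f)) (parseval n (upperHalf f)) ⟩
  ½ * 𝔼 n (λ x → sq (lowerHalf f x)) + ½ * 𝔼 n (λ x → sq (upperHalf f x))
    ≡⟨ ℚₚ.*-distribˡ-+ ½ (𝔼 n (λ x → sq (lowerHalf f x))) (𝔼 n (λ x → sq (upperHalf f x))) ⟨
  ½ * (𝔼 n (λ x → sq (lowerHalf f x)) + 𝔼 n (λ x → sq (upperHalf f x)))
    ≡⟨ 𝔼-suc n (λ x → sq (f x)) ⟨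
  𝔼 (suc n) (λ x → sq (f x)) ∎
  where
  open ≡-Reasoning
  a = fourier (lowerHalf f)
  b = fourier (upperHalf f)
  half-parallelogram : ∀ u v → sq (½ * (u + v)) + sq (½ * (v - u)) ≡ ½ * sq u + ½ * sq v
  half-parallelogram = solve 2 (λ u v → (con ½ :* (u :+ v)) :* (con ½ :* (u :+ v)) :+ (con ½ :* (v :- u)) :* (con ½ :* (v :- u))
    := con ½ :* (u :* u) :+ con ½ :* (v :* v)) refl

-- Splitting on the first coordinate, characters containing it gain one in
-- cardinality; the extra mass is the squared derivative, by Parseval.
influence-suc : ∀ n (f : Vec Bool (suc n) → ℚ) →
  influence f ≡ ½ * (influence (lowerHalf f) + influence (upperHalf f))
                + ½ * ½ * 𝔼 n (λ x → sq (upperHalf f x - lowerHalf f x))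
influence-suc n f = begin
  influence f
    ≡⟨ cubeSum-suc n _ ⟩
  cubeSum n (λ T → sq (fourier f (false ∷ T)) * κ T) + cubeSum n (λ T → sq (fourier f (true ∷ T)) * fromℕ (suc (card T)))
    ≡⟨ cubeSum-+ n _ _ ⟨
  cubeSum n (λ T → sq (fourier f (false ∷ T)) * κ T + sq (fourier f (true ∷ T)) * fromℕ (suc (card T)))
    ≡⟨ cubeSum-cong (λ T → trans
         (cong₃ (λ u v k → sq u * κ T + sq v * k) (fourier-false∷ f T) (fourier-true∷ f T) (fromℕ-suc (card T)))
         (split-weights (a T) (b T) (κ T))) ⟩
  cubeSum n (λ T → ½ * (sq (a T) * κ T + sq (b T) * κ T) + ½ * ½ * sq (b T - a T))
    ≡⟨ cubeSum-linear n ½ (½ * ½) _ _ ⟩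
  ½ * cubeSum n (λ T → sq (a T) * κ T + sq (b T) * κ T) + ½ * ½ * cubeSum n (λ T → sq (b T - a T))
    ≡⟨ cong₂ (λ u v → ½ * u + ½ * ½ * v) (cubeSum-+ n _ _)
         (trans (cubeSum-cong (λ T → cong sq (sym (fourier-sub (upperHalf f) (lowerHalf f) T))))
                (parseval n (λ x → upperHalf f x - lowerHalf f x))) ⟩
  ½ * (influence (lowerHalf f) + influence (upperHalf f)) + ½ * ½ * 𝔼 n (λ x → sq (upperHalf f x - lowerHalf f x)) ∎
  where
  open ≡-Reasoning
  a = fourier (lowerHalf f)
  b = fourier (upperHalf f)
  κ : Vec Bool n → ℚ
  κ T = fromℕ (card T)
  cong₃ : ∀ {A B C D : Set} (g : A → B → C → D) {x x′ y y′ z z′} → x ≡ x′ → y ≡ y′ → z ≡ z′ → g x y z ≡ g x′ y′ z′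
  cong₃ g refl refl refl = refl
  split-weights : ∀ u v k → sq (½ * (u + v)) * k + sq (½ * (v - u)) * (1ℚ + k)
                          ≡ ½ * (sq u * k + sq v * k) + ½ * ½ * sq (v - u)
  split-weights = solve 3 (λ u v k →
    (con ½ :* (u :+ v)) :* (con ½ :* (u :+ v)) :* k :+ (con ½ :* (v :- u)) :* (con ½ :* (v :- u)) :* (con 1ℚ :+ k)
    := con ½ :* (u :* u :* k :+ v :* v :* k) :+ con ½ :* con ½ :* ((v :- u) :* (v :- u))) refl

influence-cong : ∀ {n} {g h : Vec Bool n → ℚ} → (∀ x → g x ≡ h x) → influence g ≡ influence h
influence-cong g≗h = cubeSum-cong (λ T → cong (λ c → sq c * fromℕ (card T)) (fourier-cong g≗h T))

influence-const : ∀ n c → influence {n} (λ _ → c) ≡ 0ℚ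
influence-const zero c = solve 1 (λ c → (con 1ℚ :* (c :* con 1ℚ :+ con 0ℚ)) :* (con 1ℚ :* (c :* con 1ℚ :+ con 0ℚ)) :* con 0ℚ :+ con 0ℚ
  := con 0ℚ) refl c
influence-const (suc n) c = begin
  influence {suc n} (λ _ → c)
    ≡⟨ influence-suc n (λ _ → c) ⟩
  ½ * (influence {n} (λ _ → c) + influence {n} (λ _ → c)) + ½ * ½ * 𝔼 n (λ _ → sq (c - c))
    ≡⟨ cong₂ (λ u e → ½ * (u + u) + ½ * ½ * e) (influence-const n c)
         (trans (𝔼-const n (sq (c - c))) (cong sq (ℚₚ.+-inverseʳ c))) ⟩
  ½ * (0ℚ + 0ℚ) + ½ * ½ * sq 0ℚ ≡⟨⟩
  0ℚ ∎
  where open ≡-Reasoning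

-- Lexicographic functions

IsSign : ℚ → Set
IsSign y = y ≡ 1ℚ ⊎ y ≡ - 1ℚ

-- Stated in the shape p * 1 + q * y taken by 𝔼-linear.
sq-sub-sign : ∀ {y c} → IsSign y → IsSign c → sq (y - c) ≡ (1ℚ + 1ℚ) * 1ℚ + - (c + c) * y
sq-sub-sign (inj₁ refl) (inj₁ refl) = refl
sq-sub-sign (inj₁ refl) (inj₂ refl) = refl
sq-sub-sign (inj₂ refl) (inj₁ refl) = refl
sq-sub-sign (inj₂ refl) (inj₂ refl) = refl

𝔼-sq-sub-sign : ∀ n (g : Vec Bool n → ℚ) {c} → (∀ x → IsSign (g x)) → IsSign c →
  𝔼 n (λ x → sq (g x - c)) ≡ (1ℚ + 1ℚ) * (1ℚ - c * 𝔼 n g)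
𝔼-sq-sub-sign n g {c} g± c± = begin
  𝔼 n (λ x → sq (g x - c))
    ≡⟨ 𝔼-cong (λ x → sq-sub-sign (g± x) c±) ⟩
  𝔼 n (λ x → (1ℚ + 1ℚ) * 1ℚ + - (c + c) * g x)
    ≡⟨ 𝔼-linear n (1ℚ + 1ℚ) (- (c + c)) (λ _ → 1ℚ) g ⟩
  (1ℚ + 1ℚ) * 𝔼 n (λ _ → 1ℚ) + - (c + c) * 𝔼 n g
    ≡⟨ cong (λ e → (1ℚ + 1ℚ) * e + - (c + c) * 𝔼 n g) (𝔼-const n 1ℚ) ⟩
  (1ℚ + 1ℚ) * 1ℚ + - (c + c) * 𝔼 n g
    ≡⟨ solve 2 (λ c e → (con 1ℚ :+ con 1ℚ) :* con 1ℚ :+ (:- (c :+ c)) :* e := (con 1ℚ :+ con 1ℚ) :* (con 1ℚ :- c :* e)) refl c (𝔼 n g) ⟩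
  (1ℚ + 1ℚ) * (1ℚ - c * 𝔼 n g) ∎
  where open ≡-Reasoning

influence-upperHalf-const : ∀ n (f : Vec Bool (suc n) → ℚ) c → (∀ x → upperHalf f x ≡ c) →
  influence f ≡ ½ * influence (lowerHalf f) + ½ * ½ * 𝔼 n (λ x → sq (lowerHalf f x - c))
influence-upperHalf-const n f c f₁≡c = begin
  influence f
    ≡⟨ influence-suc n f ⟩
  ½ * (influence (lowerHalf f) + influence (upperHalf f)) + ½ * ½ * 𝔼 n (λ x → sq (upperHalf f x - lowerHalf f x))
    ≡⟨ cong₂ (λ u e → ½ * (influence (lowerHalf f) + u) + ½ * ½ * e)
         (trans (influence-cong f₁≡c) (influence-const n c))
         (𝔼-cong (λ x → trans (cong (λ u → sq (u - lowerHalf f x)) (f₁≡c x)) (sq-sub-comm c (lowerHalf f x)))) ⟩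
  ½ * (influence (lowerHalf f) + 0ℚ) + ½ * ½ * 𝔼 n (λ x → sq (lowerHalf f x - c))
    ≡⟨ cong (λ u → ½ * u + ½ * ½ * 𝔼 n (λ x → sq (lowerHalf f x - c))) (ℚₚ.+-identityʳ (influence (lowerHalf f))) ⟩
  ½ * influence (lowerHalf f) + ½ * ½ * 𝔼 n (λ x → sq (lowerHalf f x - c)) ∎
  where
  open ≡-Reasoning
  sq-sub-comm : ∀ u v → sq (u - v) ≡ sq (v - u)
  sq-sub-comm = solve 2 (λ u v → (u :- v) :* (u :- v) := (v :- u) :* (v :- u)) refl

influence-lowerHalf-const : ∀ n (f : Vec Bool (suc n) → ℚ) c → (∀ x → lowerHalf f x ≡ c) →
  influence f ≡ ½ * influence (upperHalf f) + ½ * ½ * 𝔼 n (λ x → sq (upperHalf f x - c))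
influence-lowerHalf-const n f c f₀≡c = begin
  influence f
    ≡⟨ influence-suc n f ⟩
  ½ * (influence (lowerHalf f) + influence (upperHalf f)) + ½ * ½ * 𝔼 n (λ x → sq (upperHalf f x - lowerHalf f x))
    ≡⟨ cong₂ (λ u e → ½ * (u + influence (upperHalf f)) + ½ * ½ * e)
         (trans (influence-cong f₀≡c) (influence-const n c))
         (𝔼-cong (λ x → cong (λ u → sq (upperHalf f x - u)) (f₀≡c x))) ⟩
  ½ * (0ℚ + influence (upperHalf f)) + ½ * ½ * 𝔼 n (λ x → sq (upperHalf f x - c))
    ≡⟨ cong (λ u → ½ * u + ½ * ½ * 𝔼 n (λ x → sq (upperHalf f x - c))) (ℚₚ.+-identityˡ (influence (upperHalf f))) ⟩
  ½ * influence (upperHalf f) + ½ * ½ * 𝔼 n (λ x → sq (upperHalf f x - c)) ∎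
  where open ≡-Reasoning

lexFun-sign : ∀ n s x → IsSign (lexFun n s x)
lexFun-sign n s x with val x <ᵇ s
... | true = inj₂ refl
... | false = inj₁ refl

lexFun-≥ : ∀ n s x → s ≤ val x → lexFun n s x ≡ 1ℚ
lexFun-≥ n s x s≤v with val x <ᵇ s | ℕₚ.<ᵇ⇒< (val x) s
... | false | _ = refl
... | true | v<s = contradiction (v<s _) (ℕₚ.≤⇒≯ s≤v)

lexFun-< : ∀ n s x → val x ℕ.< s → lexFun n s x ≡ - 1ℚ
lexFun-< n s x v<s with val x <ᵇ s | ℕₚ.<⇒<ᵇ v<s
... | true | _ = refl

+-cancelˡ-<ᵇ : ∀ k m n → ((k ℕ.+ m) <ᵇ (k ℕ.+ n)) ≡ (m <ᵇ n)
+-cancelˡ-<ᵇ zero m n = refl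
+-cancelˡ-<ᵇ (suc k) m n = +-cancelˡ-<ᵇ k m n

val<2^ : ∀ {n} (x : Vec Bool n) → val x ℕ.< 2 ^ n
val<2^ [] = s≤s z≤n
val<2^ {suc n} (false ∷ x) = ℕₚ.<-≤-trans (val<2^ x) (ℕₚ.m≤m+n (2 ^ n) (2 ^ n ℕ.+ 0))
val<2^ {suc n} (true ∷ x) = ℕₚ.+-monoʳ-< (2 ^ n) (ℕₚ.<-≤-trans (val<2^ x) (ℕₚ.m≤m+n (2 ^ n) 0))

lexMean : ℕ → ℕ → ℚ
lexMean n s = 𝔼 n (lexFun n s)

-- lowerHalf (lexFun (suc n) s) is lexFun n s by definition: val (false ∷ x) reduces to val x.
module LexSuc (n s : ℕ) where

  upperHalf-lexFun-≤ : s ≤ 2 ^ n → ∀ x → upperHalf (lexFun (suc n) s) x ≡ 1ℚ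
  upperHalf-lexFun-≤ s≤2ⁿ x = lexFun-≥ (suc n) s (true ∷ x) (ℕₚ.≤-trans s≤2ⁿ (ℕₚ.m≤m+n (2 ^ n) (val x)))

  lowerHalf-lexFun-2ⁿ+ : ∀ x → lowerHalf (lexFun (suc n) (2 ^ n ℕ.+ s)) x ≡ - 1ℚ
  lowerHalf-lexFun-2ⁿ+ x = lexFun-< (suc n) (2 ^ n ℕ.+ s) (false ∷ x) (ℕₚ.<-≤-trans (val<2^ x) (ℕₚ.m≤m+n (2 ^ n) s))

  upperHalf-lexFun-2ⁿ+ : ∀ x → upperHalf (lexFun (suc n) (2 ^ n ℕ.+ s)) x ≡ lexFun n s x
  upperHalf-lexFun-2ⁿ+ x = cong (λ c → if c then - 1ℚ else 1ℚ) (+-cancelˡ-<ᵇ (2 ^ n) (val x) s)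

  lexMean-suc-≤ : s ≤ 2 ^ n → lexMean (suc n) s ≡ ½ * (lexMean n s + 1ℚ)
  lexMean-suc-≤ s≤2ⁿ = trans (𝔼-suc n (lexFun (suc n) s))
    (cong (λ e → ½ * (lexMean n s + e)) (trans (𝔼-cong (upperHalf-lexFun-≤ s≤2ⁿ)) (𝔼-const n 1ℚ)))

  lexMean-suc-2ⁿ+ : lexMean (suc n) (2 ^ n ℕ.+ s) ≡ ½ * (- 1ℚ + lexMean n s)
  lexMean-suc-2ⁿ+ = trans (𝔼-suc n (lexFun (suc n) (2 ^ n ℕ.+ s)))
    (cong₂ (λ a b → ½ * (a + b)) (trans (𝔼-cong lowerHalf-lexFun-2ⁿ+) (𝔼-const n (- 1ℚ))) (𝔼-cong upperHalf-lexFun-2ⁿ+))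

  influence-lexFun-suc-≤ : s ≤ 2 ^ n → influence (lexFun (suc n) s) ≡ ½ * influence (lexFun n s) + ½ * (1ℚ - lexMean n s)
  influence-lexFun-suc-≤ s≤2ⁿ = begin
    influence (lexFun (suc n) s)
      ≡⟨ influence-upperHalf-const n (lexFun (suc n) s) 1ℚ (upperHalf-lexFun-≤ s≤2ⁿ) ⟩
    ½ * influence (lexFun n s) + ½ * ½ * 𝔼 n (λ x → sq (lexFun n s x - 1ℚ))
      ≡⟨ cong (λ e → ½ * influence (lexFun n s) + ½ * ½ * e) (𝔼-sq-sub-sign n (lexFun n s) (lexFun-sign n s) (inj₁ refl)) ⟩
    ½ * influence (lexFun n s) + ½ * ½ * ((1ℚ + 1ℚ) * (1ℚ - 1ℚ * lexMean n s))
      ≡⟨ solve 2 (λ J M → con ½ :* J :+ con ½ :* con ½ :* ((con 1ℚ :+ con 1ℚ) :* (con 1ℚ :- con 1ℚ :* M))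
                          := con ½ :* J :+ con ½ :* (con 1ℚ :- M)) refl (influence (lexFun n s)) (lexMean n s) ⟩
    ½ * influence (lexFun n s) + ½ * (1ℚ - lexMean n s) ∎
    where open ≡-Reasoning

  influence-lexFun-suc-2ⁿ+ : influence (lexFun (suc n) (2 ^ n ℕ.+ s)) ≡ ½ * influence (lexFun n s) + ½ * (1ℚ + lexMean n s)
  influence-lexFun-suc-2ⁿ+ = begin
    influence (lexFun (suc n) (2 ^ n ℕ.+ s))
      ≡⟨ influence-lowerHalf-const n (lexFun (suc n) (2 ^ n ℕ.+ s)) (- 1ℚ) lowerHalf-lexFun-2ⁿ+ ⟩
    ½ * influence (upperHalf (lexFun (suc n) (2 ^ n ℕ.+ s))) + ½ * ½ * 𝔼 n (λ x → sq (upperHalf (lexFun (suc n) (2 ^ n ℕ.+ s)) x - - 1ℚ))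
      ≡⟨ cong₂ (λ J e → ½ * J + ½ * ½ * e) (influence-cong upperHalf-lexFun-2ⁿ+)
           (𝔼-cong (λ x → cong (λ u → sq (u - - 1ℚ)) (upperHalf-lexFun-2ⁿ+ x))) ⟩
    ½ * influence (lexFun n s) + ½ * ½ * 𝔼 n (λ x → sq (lexFun n s x - - 1ℚ))
      ≡⟨ cong (λ e → ½ * influence (lexFun n s) + ½ * ½ * e) (𝔼-sq-sub-sign n (lexFun n s) (lexFun-sign n s) (inj₂ refl)) ⟩
    ½ * influence (lexFun n s) + ½ * ½ * ((1ℚ + 1ℚ) * (1ℚ - - 1ℚ * lexMean n s))
      ≡⟨ solve 2 (λ J M → con ½ :* J :+ con ½ :* con ½ :* ((con 1ℚ :+ con 1ℚ) :* (con 1ℚ :- con (- 1ℚ) :* M))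
                          := con ½ :* J :+ con ½ :* (con 1ℚ :+ M)) refl (influence (lexFun n s)) (lexMean n s) ⟩
    ½ * influence (lexFun n s) + ½ * (1ℚ + lexMean n s) ∎
    where open ≡-Reasoning

-- Binary digits

shift : (ℕ → Bool) → ℕ → Bool
shift b j = b (suc j)

prefix-shift : ∀ b n → prefix b (suc n) ≡ (if b 0 then 2 ^ n else 0) ℕ.+ prefix (shift b) n
prefix-shift b zero with b 0
... | true = refl
... | false = refl
prefix-shift b (suc n) rewrite prefix-shift b n with b 0
... | false = refl
... | true = begin
  2 ℕ.* (2 ^ n ℕ.+ p) ℕ.+ d      ≡⟨ cong (ℕ._+ d) (ℕₚ.*-distribˡ-+ 2 (2 ^ n) p) ⟩
  2 ℕ.* 2 ^ n ℕ.+ 2 ℕ.* p ℕ.+ d  ≡⟨ ℕₚ.+-assoc (2 ^ suc n) (2 ℕ.* p) d ⟩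
  2 ^ suc n ℕ.+ (2 ℕ.* p ℕ.+ d)  ∎
  where
  open ≡-Reasoning
  p = prefix (shift b) n
  d = if b (suc n) then 1 else 0

prefix<2^ : ∀ b n → prefix b n ℕ.< 2 ^ n
prefix<2^ b zero = s≤s z≤n
prefix<2^ b (suc n) = ℕₚ.<-≤-trans (2p+d<2+2p (prefix b n) (b n))
  (ℕₚ.≤-trans (ℕₚ.≤-reflexive (sym (ℕₚ.*-suc 2 (prefix b n)))) (ℕₚ.*-monoʳ-≤ 2 (prefix<2^ b n)))
  where
  2p+d<2+2p : ∀ p c → 2 ℕ.* p ℕ.+ (if c then 1 else 0) ℕ.< 2 ℕ.+ 2 ℕ.* p
  2p+d<2+2p p true = subst (ℕ._< 2 ℕ.+ 2 ℕ.* p) (ℕₚ.+-comm 1 (2 ℕ.* p)) ℕₚ.≤-refl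
  2p+d<2+2p p false = subst (ℕ._< 2 ℕ.+ 2 ℕ.* p) (sym (ℕₚ.+-identityʳ (2 ℕ.* p))) (ℕₚ.m≤n+m (suc (2 ℕ.* p)) 1)

ones-shift : ∀ b n → ones b (suc n) ≡ (if b 0 then 1 else 0) ℕ.+ ones (shift b) n
ones-shift b zero = ℕₚ.+-comm 0 (if b 0 then 1 else 0)
ones-shift b (suc n) rewrite ones-shift b n =
  ℕₚ.+-assoc (if b 0 then 1 else 0) (ones (shift b) n) (if b (suc n) then 1 else 0)

ones≤ : ∀ b j → ones b j ≤ j
ones≤ b zero = z≤n
ones≤ b (suc j) with b j
... | true = subst (_≤ suc j) (ℕₚ.+-comm 1 (ones b j)) (s≤s (ones≤ b j))
... | false = subst (_≤ suc j) (sym (ℕₚ.+-identityʳ (ones b j))) (ℕₚ.m≤n⇒m≤1+n (ones≤ b j))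

bit : Bool → ℚ
bit true = 1ℚ
bit false = 0ℚ

digitSign : Bool → ℚ
digitSign true = - 1ℚ
digitSign false = 1ℚ

-- truncation b n = Σ_{j<n} b_j 2^{-(j+1)} = ⌊μ 2ⁿ⌋ / 2ⁿ.
truncation : (ℕ → Bool) → ℕ → ℚ
truncation b zero = 0ℚ
truncation b (suc j) = truncation b j + bit (b j) * inv2^ (suc j)

truncation-shift : ∀ b n → truncation b (suc n) ≡ ½ * (bit (b 0) + truncation (shift b) n)
truncation-shift b zero = solve 1 (λ d → con 0ℚ :+ d :* (con ½ :* con 1ℚ) := con ½ :* (d :+ con 0ℚ)) refl (bit (b 0))
truncation-shift b (suc n) rewrite truncation-shift b n =
  solve 4 (λ d t e i → con ½ :* (d :+ t) :+ e :* (con ½ :* i) := con ½ :* (d :+ (t :+ e :* i))) refl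
    (bit (b 0)) (truncation (shift b) n) (bit (b (suc n))) (inv2^ (suc n))

-- For a 1-digit at position k_i = j + 1 (so i = ones b j) these are k_i − 2i and
-- the i-th term of the series; partialSum b (suc j) is partialSum b j + summand b j
-- by definition.
weight : (ℕ → Bool) → ℕ → ℚ
weight b j = (+ suc j ℤ.- + (2 ℕ.* ones b j)) / 1

summand : (ℕ → Bool) → ℕ → ℚ
summand b j = if b j then weight b j * inv2^ j else 0ℚ

weight≡ : ∀ b j → weight b j ≡ fromℕ (suc j) - fromℕ 2 * fromℕ (ones b j)
weight≡ b j = trans (ℤ→ℚ-homo-+ (+ suc j) (ℤ.- + (2 ℕ.* ones b j)))
  (cong (λ e → fromℕ (suc j) + e) (trans (ℤ→ℚ-homo-neg (+ (2 ℕ.* ones b j))) (cong -_ (fromℕ-homo-* 2 (ones b j)))))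

weight-shift : ∀ b j → weight b (suc j) ≡ weight (shift b) j + digitSign (b 0)
weight-shift b j = begin
  weight b (suc j)
    ≡⟨ weight≡ b (suc j) ⟩
  fromℕ (suc (suc j)) - fromℕ 2 * fromℕ (ones b (suc j))
    ≡⟨ cong₂ (λ u o → u - fromℕ 2 * o) (fromℕ-suc (suc j)) (trans (cong fromℕ (ones-shift b j)) (fromℕ-homo-+ (if b 0 then 1 else 0) (ones (shift b) j))) ⟩
  1ℚ + fromℕ (suc j) - fromℕ 2 * (fromℕ (if b 0 then 1 else 0) + fromℕ (ones (shift b) j))
    ≡⟨ leading-digit (b 0) (fromℕ (suc j)) (fromℕ (ones (shift b) j)) ⟩
  fromℕ (suc j) - fromℕ 2 * fromℕ (ones (shift b) j) + digitSign (b 0)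
    ≡⟨ cong (_+ digitSign (b 0)) (weight≡ (shift b) j) ⟨
  weight (shift b) j + digitSign (b 0) ∎
  where
  open ≡-Reasoning
  leading-digit : ∀ c u o → 1ℚ + u - fromℕ 2 * (fromℕ (if c then 1 else 0) + o) ≡ u - fromℕ 2 * o + digitSign c
  leading-digit true = solve 2 (λ u o → con 1ℚ :+ u :- con (fromℕ 2) :* (con 1ℚ :+ o) := u :- con (fromℕ 2) :* o :+ con (- 1ℚ)) refl
  leading-digit false = solve 2 (λ u o → con 1ℚ :+ u :- con (fromℕ 2) :* (con 0ℚ :+ o) := u :- con (fromℕ 2) :* o :+ con 1ℚ) refl

summand-shift : ∀ b j → summand b (suc j) ≡ ½ * (summand (shift b) j + digitSign (b 0) * (bit (b (suc j)) * inv2^ j))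
summand-shift b j with b (suc j)
... | true = trans (cong (_* inv2^ (suc j)) (weight-shift b j))
  (solve 3 (λ w σ i → (w :+ σ) :* (con ½ :* i) := con ½ :* (w :* i :+ σ :* (con 1ℚ :* i))) refl
    (weight (shift b) j) (digitSign (b 0)) (inv2^ j))
... | false = solve 2 (λ σ i → con 0ℚ := con ½ :* (con 0ℚ :+ σ :* (con 0ℚ :* i))) refl (digitSign (b 0)) (inv2^ j)

-- A leading digit shifts every later position k_i by one, and also the index i
-- when that digit is 1; the resulting correction is exactly the truncation.
partialSum-shift : ∀ b n →
  partialSum b (suc n) ≡ ½ * partialSum (shift b) n + (bit (b 0) + digitSign (b 0) * truncation (shift b) n)
partialSum-shift b zero with b 0
... | true = refl
... | false = refl
partialSum-shift b (suc n) = begin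
  partialSum b (suc n) + summand b (suc n)
    ≡⟨ cong₂ _+_ (partialSum-shift b n) (summand-shift b n) ⟩
  ½ * P + (d + σ * t) + ½ * (summand (shift b) n + σ * (B * inv2^ n))
    ≡⟨ solve 7 (λ P d σ t S B i →
         con ½ :* P :+ (d :+ σ :* t) :+ con ½ :* (S :+ σ :* (B :* i))
         := con ½ :* (P :+ S) :+ (d :+ σ :* (t :+ B :* (con ½ :* i)))) refl
         P d σ t (summand (shift b) n) B (inv2^ n) ⟩
  ½ * (P + summand (shift b) n) + (d + σ * (t + B * inv2^ (suc n))) ∎
  where
  open ≡-Reasoning
  P = partialSum (shift b) n
  t = truncation (shift b) n
  d = bit (b 0)
  σ = digitSign (b 0)
  B = bit (b (suc n))

lexMean-prefix : ∀ n b → lexMean n (prefix b n) ≡ 1ℚ - (truncation b n + truncation b n)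
lexMean-prefix zero b = refl
lexMean-prefix (suc n) b = begin
  lexMean (suc n) (prefix b (suc n))
    ≡⟨ cong (lexMean (suc n)) (prefix-shift b n) ⟩
  lexMean (suc n) ((if b 0 then 2 ^ n else 0) ℕ.+ p)
    ≡⟨ leading (b 0) ⟩
  1ℚ - (½ * (bit (b 0) + t) + ½ * (bit (b 0) + t))
    ≡⟨ cong (λ T → 1ℚ - (T + T)) (truncation-shift b n) ⟨
  1ℚ - (truncation b (suc n) + truncation b (suc n)) ∎
  where
  open ≡-Reasoning
  p = prefix (shift b) n
  t = truncation (shift b) n
  leading : ∀ c → lexMean (suc n) ((if c then 2 ^ n else 0) ℕ.+ p) ≡ 1ℚ - (½ * (bit c + t) + ½ * (bit c + t))
  leading true = begin
    lexMean (suc n) (2 ^ n ℕ.+ p)  ≡⟨ LexSuc.lexMean-suc-2ⁿ+ n p ⟩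
    ½ * (- 1ℚ + lexMean n p)       ≡⟨ cong (λ M → ½ * (- 1ℚ + M)) (lexMean-prefix n (shift b)) ⟩
    ½ * (- 1ℚ + (1ℚ - (t + t)))    ≡⟨ solve 1 (λ t → con ½ :* (con (- 1ℚ) :+ (con 1ℚ :- (t :+ t)))
                                        := con 1ℚ :- (con ½ :* (con 1ℚ :+ t) :+ con ½ :* (con 1ℚ :+ t))) refl t ⟩
    1ℚ - (½ * (1ℚ + t) + ½ * (1ℚ + t)) ∎
  leading false = begin
    lexMean (suc n) p              ≡⟨ LexSuc.lexMean-suc-≤ n p (ℕₚ.<⇒≤ (prefix<2^ (shift b) n)) ⟩
    ½ * (lexMean n p + 1ℚ)         ≡⟨ cong (λ M → ½ * (M + 1ℚ)) (lexMean-prefix n (shift b)) ⟩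
    ½ * (1ℚ - (t + t) + 1ℚ)        ≡⟨ solve 1 (λ t → con ½ :* (con 1ℚ :- (t :+ t) :+ con 1ℚ)
                                        := con 1ℚ :- (con ½ :* (con 0ℚ :+ t) :+ con ½ :* (con 0ℚ :+ t))) refl t ⟩
    1ℚ - (½ * (0ℚ + t) + ½ * (0ℚ + t)) ∎

influence-lexFun-prefix : ∀ n b → influence (lexFun n (prefix b n)) ≡ partialSum b n
influence-lexFun-prefix zero b = refl
influence-lexFun-prefix (suc n) b = begin
  influence (lexFun (suc n) (prefix b (suc n)))
    ≡⟨ cong (λ s → influence (lexFun (suc n) s)) (prefix-shift b n) ⟩
  influence (lexFun (suc n) ((if b 0 then 2 ^ n else 0) ℕ.+ p))
    ≡⟨ leading (b 0) ⟩
  ½ * P + (bit (b 0) + digitSign (b 0) * t)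
    ≡⟨ partialSum-shift b n ⟨
  partialSum b (suc n) ∎
  where
  open ≡-Reasoning
  p = prefix (shift b) n
  t = truncation (shift b) n
  P = partialSum (shift b) n
  M≡ = lexMean-prefix n (shift b)
  J≡ = influence-lexFun-prefix n (shift b)
  leading : ∀ c → influence (lexFun (suc n) ((if c then 2 ^ n else 0) ℕ.+ p)) ≡ ½ * P + (bit c + digitSign c * t)
  leading true = begin
    influence (lexFun (suc n) (2 ^ n ℕ.+ p))              ≡⟨ LexSuc.influence-lexFun-suc-2ⁿ+ n p ⟩
    ½ * influence (lexFun n p) + ½ * (1ℚ + lexMean n p)   ≡⟨ cong₂ (λ J M → ½ * J + ½ * (1ℚ + M)) J≡ M≡ ⟩
    ½ * P + ½ * (1ℚ + (1ℚ - (t + t)))                     ≡⟨ solve 2 (λ P t → con ½ :* P :+ con ½ :* (con 1ℚ :+ (con 1ℚ :- (t :+ t)))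
                                                               := con ½ :* P :+ (con 1ℚ :+ con (- 1ℚ) :* t)) refl P t ⟩
    ½ * P + (1ℚ + - 1ℚ * t) ∎
  leading false = begin
    influence (lexFun (suc n) p)                          ≡⟨ LexSuc.influence-lexFun-suc-≤ n p (ℕₚ.<⇒≤ (prefix<2^ (shift b) n)) ⟩
    ½ * influence (lexFun n p) + ½ * (1ℚ - lexMean n p)   ≡⟨ cong₂ (λ J M → ½ * J + ½ * (1ℚ - M)) J≡ M≡ ⟩
    ½ * P + ½ * (1ℚ - (1ℚ - (t + t)))                     ≡⟨ solve 2 (λ P t → con ½ :* P :+ con ½ :* (con 1ℚ :- (con 1ℚ :- (t :+ t)))
                                                               := con ½ :* P :+ (con 0ℚ :+ con 1ℚ :* t)) refl P t ⟩
    ½ * P + (0ℚ + 1ℚ * t) ∎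

-- Convergence of the partial sums

∣weight∣≤ : ∀ b j → ∣ weight b j ∣ ≤ℚ fromℕ 2 * fromℕ (suc j)
∣weight∣≤ b j = begin
  ∣ (+ suc j ℤ.- + o₂) / 1 ∣      ≡⟨ ∣ℤ→ℚ∣ (+ suc j ℤ.- + o₂) ⟩
  fromℕ ℤ.∣ + suc j ℤ.- + o₂ ∣    ≡⟨ cong (λ i → fromℕ ℤ.∣ i ∣) (ℤₚ.m-n≡m⊖n (suc j) o₂) ⟩
  fromℕ ℤ.∣ suc j ℤ.⊖ o₂ ∣        ≤⟨ fromℕ-mono-≤ (ℕₚ.≤-trans (ℤₚ.∣m⊝n∣≤m⊔n (suc j) o₂)
                                      (ℕₚ.⊔-lub (ℕₚ.m≤n*m (suc j) 2) (ℕₚ.*-monoʳ-≤ 2 (ℕₚ.m≤n⇒m≤1+n (ones≤ b j))))) ⟩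
  fromℕ (2 ℕ.* suc j)             ≡⟨ fromℕ-homo-* 2 (suc j) ⟩
  fromℕ 2 * fromℕ (suc j)         ∎
  where
  open ℚₚ.≤-Reasoning
  o₂ = 2 ℕ.* ones b j

summandBound : ℕ → ℚ
summandBound j = fromℕ 2 * fromℕ (suc j) * inv2^ j

∣summand∣≤ : ∀ b j → ∣ summand b j ∣ ≤ℚ summandBound j
∣summand∣≤ b j with b j
... | true = begin
  ∣ weight b j * inv2^ j ∣          ≡⟨ ℚₚ.∣p*q∣≡∣p∣*∣q∣ (weight b j) (inv2^ j) ⟩
  ∣ weight b j ∣ * ∣ inv2^ j ∣      ≡⟨ cong (∣ weight b j ∣ *_) (ℚₚ.0≤p⇒∣p∣≡p (inv2^-nonNeg j)) ⟩
  ∣ weight b j ∣ * inv2^ j          ≤⟨ ℚₚ.*-monoʳ-≤-nonNeg (inv2^ j) {{nonNegative (inv2^-nonNeg j)}} (∣weight∣≤ b j) ⟩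
  summandBound j                    ∎
  where open ℚₚ.≤-Reasoning
... | false = *-nonNeg (*-nonNeg (fromℕ-nonNeg 2) (fromℕ-nonNeg (suc j))) (inv2^-nonNeg j)

tailBound : ℕ → ℚ
tailBound N = (fromℕ N + fromℕ 2) * (fromℕ 4 * inv2^ N)

tailBound-nonNeg : ∀ N → 0ℚ ≤ℚ tailBound N
tailBound-nonNeg N = *-nonNeg (ℚₚ.+-mono-≤ (fromℕ-nonNeg N) (fromℕ-nonNeg 2)) (*-nonNeg (fromℕ-nonNeg 4) (inv2^-nonNeg N))

-- Σ_{j ≥ N} 2 (j + 1) 2^{-j} = (4 N + 8) 2^{-N}, term by term.
summandBound+tailBound : ∀ N → summandBound N + tailBound (suc N) ≡ tailBound N
summandBound+tailBound N = trans (cong (λ x → fromℕ 2 * x * i + (x + fromℕ 2) * (fromℕ 4 * (½ * i))) (fromℕ-suc N))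
  (solve 2 (λ x i → con (fromℕ 2) :* (con 1ℚ :+ x) :* i :+ (con 1ℚ :+ x :+ con (fromℕ 2)) :* (con (fromℕ 4) :* (con ½ :* i))
    := (x :+ con (fromℕ 2)) :* (con (fromℕ 4) :* i)) refl (fromℕ N) i)
  where i = inv2^ N

partialSum-tail : ∀ b N k → ∣ partialSum b (N ℕ.+ k) - partialSum b N ∣ + tailBound (N ℕ.+ k) ≤ℚ tailBound N
partialSum-tail b N zero rewrite ℕₚ.+-identityʳ N | ℚₚ.+-inverseʳ (partialSum b N) = ℚₚ.≤-reflexive (ℚₚ.+-identityˡ (tailBound N))
partialSum-tail b N (suc k) rewrite ℕₚ.+-suc N k = begin
  ∣ partialSum b m + summand b m - partialSum b N ∣ + tailBound (suc m)
    ≡⟨ cong (λ z → ∣ z ∣ + tailBound (suc m))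
         (solve 3 (λ a s c → a :+ s :- c := a :- c :+ s) refl (partialSum b m) (summand b m) (partialSum b N)) ⟩
  ∣ δ + summand b m ∣ + tailBound (suc m)
    ≤⟨ ℚₚ.+-monoˡ-≤ (tailBound (suc m))
         (ℚₚ.≤-trans (ℚₚ.∣p+q∣≤∣p∣+∣q∣ δ (summand b m)) (ℚₚ.+-monoʳ-≤ ∣ δ ∣ (∣summand∣≤ b m))) ⟩
  ∣ δ ∣ + summandBound m + tailBound (suc m)
    ≡⟨ trans (ℚₚ.+-assoc ∣ δ ∣ (summandBound m) (tailBound (suc m))) (cong (λ e → ∣ δ ∣ + e) (summandBound+tailBound m)) ⟩
  ∣ δ ∣ + tailBound m
    ≤⟨ partialSum-tail b N k ⟩
  tailBound N ∎
  where
  open ℚₚ.≤-Reasoning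
  m = N ℕ.+ k
  δ = partialSum b m - partialSum b N

partialSum-near : ∀ b {N n} → N ≤ n → ∣ partialSum b n - partialSum b N ∣ ≤ℚ tailBound N
partialSum-near b {N} {n} N≤n = subst (λ n′ → ∣ partialSum b n′ - partialSum b N ∣ ≤ℚ tailBound N) (ℕₚ.m+[n∸m]≡n N≤n)
  (ℚₚ.≤-trans (p≤p+q _ (tailBound-nonNeg (N ℕ.+ (n ℕ.∸ N)))) (partialSum-tail b N (n ℕ.∸ N)))

partialSum-cauchy : ∀ b {N n m} → N ≤ n → N ≤ m → ∣ partialSum b n - partialSum b m ∣ ≤ℚ tailBound N + tailBound N
partialSum-cauchy b {N} {n} {m} N≤n N≤m = begin
  ∣ partialSum b n - partialSum b m ∣
    ≡⟨ cong ∣_∣ (solve 3 (λ a c d → a :- c := a :- d :- (c :- d)) refl (partialSum b n) (partialSum b m) (partialSum b N)) ⟩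
  ∣ partialSum b n - partialSum b N - (partialSum b m - partialSum b N) ∣
    ≤⟨ ℚₚ.∣p-q∣≤∣p∣+∣q∣ (partialSum b n - partialSum b N) (partialSum b m - partialSum b N) ⟩
  ∣ partialSum b n - partialSum b N ∣ + ∣ partialSum b m - partialSum b N ∣
    ≤⟨ ℚₚ.+-mono-≤ (partialSum-near b N≤n) (partialSum-near b N≤m) ⟩
  tailBound N + tailBound N ∎
  where open ℚₚ.≤-Reasoning

-- For ε = (p + 1)/(q + 1), 1/ε = (q + 1)/(p + 1) ≤ q + 1.
archimedean : ∀ ε → 0ℚ < ε → ∃[ k ] 1ℚ ≤ℚ ε * fromℕ (suc k)
archimedean ε@(mkℚ +[1+ p ] q _) _ = q , (begin
  1ℚ                  ≡⟨ ℚₚ.*-inverseʳ ε ⟨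
  ε * 1/ ε            ≤⟨ ℚₚ.*-monoˡ-≤-nonNeg ε 1/ε≤ ⟩
  ε * fromℕ (suc q)   ∎)
  where
  open ℚₚ.≤-Reasoning
  1/ε≤ : 1/ ε ≤ℚ fromℕ (suc q)
  1/ε≤ rewrite ℚₚ.normalize-coprime {suc q} {0} (Coprime.sym (Coprime.1-coprimeTo (suc q))) =
    *≤* (ℤ.+≤+ (ℕₚ.*-monoʳ-≤ (suc q) (s≤s z≤n)))
archimedean (mkℚ (+ zero) _ _) 0<ε = contradiction (ℤ.Positive.pos (positive 0<ε)) λ ()
archimedean (mkℚ -[1+ _ ] _ _) 0<ε = contradiction (ℤ.Positive.pos (positive 0<ε)) λ ()

suc≤2^ : ∀ n → suc n ≤ 2 ^ n
suc≤2^ zero = s≤s z≤n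
suc≤2^ (suc n) = subst (_≤ 2 ^ suc n) (ℕₚ.+-comm (suc n) 1)
  (ℕₚ.+-mono-≤ (suc≤2^ n) (ℕₚ.≤-trans (s≤s z≤n) (ℕₚ.≤-trans (suc≤2^ n) (ℕₚ.m≤m+n (2 ^ n) 0))))

suc*≤2^+ : ∀ m → suc m ℕ.* m ≤ 2 ^ (m ℕ.+ m)
suc*≤2^+ m = ℕₚ.≤-trans (ℕₚ.*-mono-≤ (suc≤2^ m) (ℕₚ.≤-trans (ℕₚ.n≤1+n m) (suc≤2^ m)))
  (ℕₚ.≤-reflexive (sym (ℕₚ.^-distribˡ-+-* 2 m m)))

-- For N = m + m with m = 16 K, 2 tailBound N · K = (m + 1) m 2^{−N} ≤ 1.
tailBound-scaled≤1 : ∀ K → let m = 16 ℕ.* K in (tailBound (m ℕ.+ m) + tailBound (m ℕ.+ m)) * fromℕ K ≤ℚ 1ℚ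
tailBound-scaled≤1 K = begin
  (tailBound N + tailBound N) * k
    ≡⟨ cong (λ x → ((x + fromℕ 2) * (fromℕ 4 * i) + (x + fromℕ 2) * (fromℕ 4 * i)) * k)
         (trans (fromℕ-homo-+ m m) (cong₂ _+_ y≡ y≡)) ⟩
  ((fromℕ 16 * k + fromℕ 16 * k + fromℕ 2) * (fromℕ 4 * i) + (fromℕ 16 * k + fromℕ 16 * k + fromℕ 2) * (fromℕ 4 * i)) * k
    ≡⟨ solve 2 (λ k i → ((con (fromℕ 16) :* k :+ con (fromℕ 16) :* k :+ con (fromℕ 2)) :* (con (fromℕ 4) :* i) :+ (con (fromℕ 16) :* k :+ con (fromℕ 16) :* k :+ con (fromℕ 2)) :* (con (fromℕ 4) :* i)) :* k
                        := (con 1ℚ :+ con (fromℕ 16) :* k) :* (con (fromℕ 16) :* k) :* i) refl k i ⟩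
  (1ℚ + fromℕ 16 * k) * (fromℕ 16 * k) * i
    ≡⟨ cong (λ y → (1ℚ + y) * y * i) y≡ ⟨
  (1ℚ + fromℕ m) * fromℕ m * i
    ≡⟨ cong (_* i) (trans (fromℕ-homo-* (suc m) m) (cong (_* fromℕ m) (fromℕ-suc m))) ⟨
  fromℕ (suc m ℕ.* m) * i
    ≤⟨ ℚₚ.*-monoʳ-≤-nonNeg i {{nonNegative (inv2^-nonNeg N)}} (fromℕ-mono-≤ (suc*≤2^+ m)) ⟩
  fromℕ (2 ^ N) * i
    ≡⟨ fromℕ-2^*inv2^ N ⟩
  1ℚ ∎
  where
  open ℚₚ.≤-Reasoning
  m = 16 ℕ.* K
  N = m ℕ.+ m
  i = inv2^ N
  k = fromℕ K
  y≡ : fromℕ m ≡ fromℕ 16 * k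
  y≡ = fromℕ-homo-* 16 K

tailBound-small : ∀ ε → 0ℚ < ε → ∃[ N ] tailBound N + tailBound N ≤ℚ ε
tailBound-small ε 0<ε with archimedean ε 0<ε
... | k , 1≤εK = N , ℚₚ.*-cancelʳ-≤-pos (fromℕ (suc k)) {{ℚₚ.normalize-pos (suc k) 1}}
                       (ℚₚ.≤-trans (tailBound-scaled≤1 (suc k)) 1≤εK)
  where N = 16 ℕ.* suc k ℕ.+ 16 ℕ.* suc k

corollary9 : (b : ℕ → Bool)
    → (∃[ j ] b j ≡ true)
    → (∀ N → ∃[ j ] (N ≤ j × b j ≡ false))
    → ∀ (ε : ℚ) → 0ℚ < ε
    → ∃[ N ] (∀ n m → N ≤ n → N ≤ m
    → ∣ lexInfluence b n - partialSum b m ∣ ≤ℚ ε)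
corollary9 b _ _ ε 0<ε = let N , 2T≤ε = tailBound-small ε 0<ε in N , λ n m N≤n N≤m →
  subst (λ I → ∣ I - partialSum b m ∣ ≤ℚ ε) (sym (influence-lexFun-prefix n b))
    (ℚₚ.≤-trans (partialSum-cauchy b N≤n N≤m) 2T≤ε)
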